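{- Let $f=f_1\cdots f_n$ be a restricted growth function over $[n]$ and let $f'=f'_1\cdots f'_n$ be defined by $f'_i=f_i-u_i+\delta_i$ for $i\in[n]$, where $u_i$ is the number of positions $j<i$ such that $j\in\operatorname{LrMax}(f)$, the letter $f_j$ is unique in $f$, and $f_j<f_i$; and $\delta_i=1$ if $i\in\operatorname{LrMax}(f)$ and the letter $f_i$ occurs more than once in $f$, and $\delta_i=0$ otherwise. Then $\operatorname{LrMax}(f)\subseteq\operatorname{LwMp}(f')$.
   Context: A restricted growth function (RGF) over $[n]$ is a word $f=f_1\cdots f_n$ with $f_1=1$ and $f_i\le 1+\max\{f_1,\dots,f_{i-1}\}$ for $2\le i\le n$. A letter $f_j$ is unique in $f$ if no other position carries the same value. For a word $g=g_1\cdots g_n$: $\operatorname{LrMax}(g)=\{i: g_i>g_j \text{ for all } j<i\}$ and $\operatorname{LwMp}(g)=\{i: g_i\ge g_j \text{ for all } j<i\}$. -}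

module Defs where

open import Data.Nat as ℕ using (ℕ; zero; suc; _<_; _≤_; _⊔_)
open import Data.Fin using (Fin; toℕ)
open import Data.Integer as ℤ using (ℤ; +_)
open import Data.Product using (_×_; ∃-syntax)
open import Relation.Nullary using (¬_)
open import Relation.Binary.PropositionalEquality using (_≡_)

-- A word of length n: positions are Fin n (position i of the paper is index i-1).
Word : ℕ → Set
Word n = Fin n → ℕ

prefixMax : {n : ℕ} → Word n → ℕ → ℕ
prefixMax {n} f zero = 0
prefixMax {n} f (suc k) with k ℕ.<? n
... | Relation.Nullary.yes k<n = prefixMax f k ⊔ f (Data.Fin.fromℕ< k<n)
... | Relation.Nullary.no _ = prefixMax f k

IsRGF : {n : ℕ} → Word n → Set
IsRGF {n} f = (∀ (i : Fin n) → toℕ i ≡ 0 → f i ≡ 1)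
            × (∀ (i : Fin n) → ¬ (toℕ i ≡ 0) → f i ≤ suc (prefixMax f (toℕ i)))

InLrMax : {n : ℕ} → Word n → Fin n → Set
InLrMax {n} g i = ∀ (j : Fin n) → toℕ j < toℕ i → g j < g i

InLwMpℤ : {n : ℕ} → (Fin n → ℤ) → Fin n → Set
InLwMpℤ {n} g i = ∀ (j : Fin n) → toℕ j < toℕ i → g j ℤ.≤ g i

Unique : {n : ℕ} → Word n → Fin n → Set
Unique {n} f j = ∀ (k : Fin n) → f k ≡ f j → k ≡ j

open import Data.Fin.Properties using (all?; any?) renaming (_≟_ to _≟ᶠ_)
open import Data.List using (List; filter; length)
open import Data.List.Base using ()
open import Data.Fin using (_<?_)
open import Data.List using () renaming (allFin to allFinL)
open import Relation.Nullary using (Dec; yes; no; _×-dec_; ¬?; _→-dec_)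
open import Data.Nat.Properties using (_≟_)
open import Data.Bool using (Bool; true; false; if_then_else_)

inLrMax? : {n : ℕ} (g : Word n) (i : Fin n) → Dec (InLrMax g i)
inLrMax? g i = all? (λ j → (toℕ j ℕ.<? toℕ i) →-dec (g j ℕ.<? g i))

unique? : {n : ℕ} (f : Word n) (j : Fin n) → Dec (Unique f j)
unique? f j = all? (λ k → (f k ≟ f j) →-dec (k ≟ᶠ j))

u : {n : ℕ} → Word n → Fin n → ℕ
u {n} f i = length (filter (λ j → (toℕ j ℕ.<? toℕ i) ×-dec (inLrMax? f j ×-dec (unique? f j ×-dec (f j ℕ.<? f i)))) (allFinL n))

δ : {n : ℕ} → Word n → Fin n → ℕ
δ f i with inLrMax? f i ×-dec ¬? (unique? f i)
... | yes _ = 1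
... | no _ = 0

f′ : {n : ℕ} → Word n → Fin n → ℤ
f′ f i = (+ f i ℤ.- + u f i) ℤ.+ + δ f i

{-# OPTIONS --safe #-}
module Submission where

open import Defs

open import Data.Nat as ℕ using (ℕ; zero; suc; _+_; _∸_; _<_; _≤_; z≤n; s≤s)
open import Data.Nat.Properties
open import Data.Fin as Fin using (Fin; toℕ)
open import Data.Fin.Properties using (toℕ-injective)
open import Data.Integer as ℤ using (ℤ; +_)
import Data.Integer.Properties as ℤ
open import Data.Integer.Tactic.RingSolver using (solve-∀)
open import Data.List using (List; []; _∷_; filter; length; map; allFin)
open import Data.List.Properties using (filter-accept; length-map)
open import Data.List.Relation.Unary.All as All using (All; []; _∷_)
import Data.List.Relation.Unary.All.Properties as All
open import Data.List.Relation.Unary.AllPairs using (AllPairs; []; _∷_)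
import Data.List.Relation.Unary.AllPairs.Properties as AllPairs
open import Data.Product using (_×_; _,_)
open import Data.Sum using (_⊎_; inj₁; inj₂)
open import Function using (id)
open import Relation.Nullary using (¬_; yes; no; _×-dec_; ¬?; contradiction)
open import Relation.Unary using (Pred; Decidable)
open import Relation.Binary using (tri<; tri≈; tri>)
open import Relation.Binary.PropositionalEquality using (_≡_; refl; sym; cong; subst; subst₂)

-- For j < i with i ∈ LrMax(f), put c = f_j + δ_j ≤ f_i.  Every position counted by u_i
-- but not by u_j is a left-to-right maximum with value in [c, f_i); the values of
-- left-to-right maxima strictly increase, so there are at most f_i − c of them.  Hence
-- u_i ≤ u_j + f_i − c, which rearranges to f'_j ≤ f'_i.

length-filter-∷ : ∀ {a p} {A : Set a} {P : Pred A p} (P? : Decidable P) x xs →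
                  length (filter P? xs) ≤ length (filter P? (x ∷ xs))
length-filter-∷ P? x xs with P? x
... | yes _ = n≤1+n _
... | no _  = ≤-refl

module _ {a p q r} {A : Set a} {P : Pred A p} {Q : Pred A q} {R : Pred A r}
         (P? : Decidable P) (Q? : Decidable Q) (R? : Decidable R) where

  length-filter-≤-cover : (∀ x → P x → Q x ⊎ R x) → ∀ xs →
    length (filter P? xs) ≤ length (filter Q? xs) + length (filter R? xs)
  length-filter-≤-cover P⊆Q∪R [] = z≤n
  length-filter-≤-cover P⊆Q∪R (x ∷ xs) with P? x
  ... | no _ = ≤-trans ih (+-mono-≤ (length-filter-∷ Q? x xs) (length-filter-∷ R? x xs))
    where ih = length-filter-≤-cover P⊆Q∪R xs
  ... | yes px with P⊆Q∪R x px
  ...   | inj₁ qx = begin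
    suc (length (filter P? xs))                                  ≤⟨ s≤s (length-filter-≤-cover P⊆Q∪R xs) ⟩
    suc (length (filter Q? xs) + length (filter R? xs))          ≤⟨ s≤s (+-monoʳ-≤ _ (length-filter-∷ R? x xs)) ⟩
    length (x ∷ filter Q? xs) + length (filter R? (x ∷ xs))      ≡⟨ cong (λ ys → length ys + _) (sym (filter-accept Q? qx)) ⟩
    length (filter Q? (x ∷ xs)) + length (filter R? (x ∷ xs))    ∎
    where open ≤-Reasoning
  ...   | inj₂ rx = begin
    suc (length (filter P? xs))                                  ≤⟨ s≤s (length-filter-≤-cover P⊆Q∪R xs) ⟩
    suc (length (filter Q? xs) + length (filter R? xs))          ≤⟨ s≤s (+-monoˡ-≤ _ (length-filter-∷ Q? x xs)) ⟩
    suc (length (filter Q? (x ∷ xs)) + length (filter R? xs))    ≡⟨ sym (+-suc _ _) ⟩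
    length (filter Q? (x ∷ xs)) + length (x ∷ filter R? xs)      ≡⟨ cong (λ ys → _ + length ys) (sym (filter-accept R? rx)) ⟩
    length (filter Q? (x ∷ xs)) + length (filter R? (x ∷ xs))    ∎
    where open ≤-Reasoning

length-increasing-≤ : ∀ {m n} {xs : List ℕ} → AllPairs _<_ xs →
                      All (λ x → m ≤ x × x < n) xs → length xs ≤ n ∸ m
length-increasing-≤ [] [] = z≤n
length-increasing-≤ {m} {n} {x ∷ xs} (x<xs ∷ inc) ((m≤x , x<n) ∷ bounds) = begin
  suc (length xs)  ≤⟨ s≤s (length-increasing-≤ inc (All.zipWith shift (x<xs , bounds))) ⟩
  suc (n ∸ suc x)  ≡⟨ sym (+-∸-assoc 1 x<n) ⟩
  n ∸ x            ≤⟨ ∸-monoʳ-≤ n m≤x ⟩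
  n ∸ m            ∎
  where
  open ≤-Reasoning
  shift : ∀ {y} → x < y × (m ≤ y × y < n) → suc x ≤ y × y < n
  shift (x<y , _ , y<n) = x<y , y<n

module _ {n : ℕ} (f : Word n) where

  LrMaxIn : ℕ → ℕ → Pred (Fin n) _
  LrMaxIn a b x = InLrMax f x × (a ≤ f x × f x < b)

  lrMaxIn? : ∀ a b → Decidable (LrMaxIn a b)
  lrMaxIn? a b x = inLrMax? f x ×-dec ((a ℕ.≤? f x) ×-dec (f x ℕ.<? b))

  lrMax-values-increasing : ∀ {xs : List (Fin n)} → AllPairs Fin._<_ xs →
                            All (InLrMax f) xs → AllPairs _<_ (map f xs)
  lrMax-values-increasing [] [] = []
  lrMax-values-increasing {x ∷ _} (x<xs ∷ inc) (_ ∷ lrs) =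
    All.map⁺ (All.zipWith (λ (x<y , lr-y) → lr-y x x<y) (x<xs , lrs)) ∷ lrMax-values-increasing inc lrs

  count-lrMaxIn-≤ : ∀ a b → length (filter (lrMaxIn? a b) (allFin n)) ≤ b ∸ a
  count-lrMaxIn-≤ a b = begin
    length xs          ≡⟨ sym (length-map f xs) ⟩
    length (map f xs)  ≤⟨ length-increasing-≤ increasing (All.map⁺ (All.map (λ (_ , bounds) → bounds) inRange)) ⟩
    b ∸ a              ∎
    where
    open ≤-Reasoning
    xs = filter (lrMaxIn? a b) (allFin n)
    inRange : All (LrMaxIn a b) xs
    inRange = All.all-filter (lrMaxIn? a b) (allFin n)
    increasing : AllPairs _<_ (map f xs)
    increasing = lrMax-values-increasing
      (AllPairs.filter⁺ (lrMaxIn? a b) (AllPairs.tabulate⁺-< id))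
      (All.map (λ (lr , _) → lr) inRange)

  CountedIn-u : Fin n → Pred (Fin n) _
  CountedIn-u i j = toℕ j < toℕ i × (InLrMax f j × (Unique f j × f j < f i))

  countedIn-u? : ∀ i → Decidable (CountedIn-u i)
  countedIn-u? i j = (toℕ j ℕ.<? toℕ i) ×-dec (inLrMax? f j ×-dec (unique? f j ×-dec (f j ℕ.<? f i)))

  δ-spec : ∀ j → δ f j ≡ 0 ⊎ (δ f j ≡ 1 × InLrMax f j × ¬ Unique f j)
  δ-spec j with inLrMax? f j ×-dec ¬? (unique? f j)
  ... | yes (lr , ¬unique) = inj₂ (refl , lr , ¬unique)
  ... | no _               = inj₁ refl

  +δ≤suc : ∀ j → f j + δ f j ≤ suc (f j)
  +δ≤suc j with δ-spec j
  ... | inj₁ δ≡0       rewrite δ≡0 | +-identityʳ (f j) = n≤1+n (f j)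
  ... | inj₂ (δ≡1 , _) rewrite δ≡1 | +-comm (f j) 1    = ≤-refl

  countedIn-u-cover : ∀ {i j} → toℕ j < toℕ i → InLrMax f i → ∀ x →
    CountedIn-u i x → CountedIn-u j x ⊎ LrMaxIn (f j + δ f j) (f i) x
  countedIn-u-cover {i} {j} _ _ x (_ , lr-x , unique-x , x<i) with <-cmp (toℕ x) (toℕ j)
  ... | tri> _ _ j<x = inj₂ (lr-x , ≤-trans (+δ≤suc j) (lr-x j j<x) , x<i)
  ... | tri≈ _ x≡j _ with δ-spec j
  ...   | inj₂ (_ , _ , ¬unique-j) = contradiction (subst (Unique f) (toℕ-injective x≡j) unique-x) ¬unique-j
  ...   | inj₁ δ≡0 rewrite δ≡0 | +-identityʳ (f j) | toℕ-injective x≡j = inj₂ (lr-x , ≤-refl , x<i)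
  countedIn-u-cover {i} {j} _ _ x (_ , lr-x , unique-x , x<i) | tri< x<j _ _ with f x ℕ.<? f j
  ... | yes fx<fj = inj₁ (x<j , lr-x , unique-x , fx<fj)
  ... | no fx≮fj with δ-spec j
  ...   | inj₂ (_ , lr-j , _) = contradiction (lr-j x x<j) fx≮fj
  ...   | inj₁ δ≡0 rewrite δ≡0 | +-identityʳ (f j) = inj₂ (lr-x , ≮⇒≥ fx≮fj , x<i)

  u-≤ : ∀ {i j} → toℕ j < toℕ i → InLrMax f i → u f i ≤ u f j + (f i ∸ (f j + δ f j))
  u-≤ {i} {j} j<i lr-i =
    ≤-trans (length-filter-≤-cover (countedIn-u? i) (countedIn-u? j) (lrMaxIn? c (f i))
                                   (countedIn-u-cover j<i lr-i) (allFin n))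
            (+-monoʳ-≤ (u f j) (count-lrMaxIn-≤ c (f i)))
    where c = f j + δ f j

-- both sides are moved so that no subtraction occurs
m-n+o≤p-q+r : ∀ m n o p q r → m + o + q ≤ p + r + n →
              (+ m ℤ.- + n) ℤ.+ + o ℤ.≤ (+ p ℤ.- + q) ℤ.+ + r
m-n+o≤p-q+r m n o p q r le =
  subst₂ ℤ._≤_ (cancelˡ (+ m) (+ o) (+ q) (+ n)) (cancelʳ (+ p) (+ r) (+ n) (+ q))
         (ℤ.+-monoˡ-≤ (ℤ.- (+ n ℤ.+ + q)) (ℤ.+≤+ le))
  where
  cancelˡ : ∀ (a b c d : ℤ) → a ℤ.+ b ℤ.+ c ℤ.- (d ℤ.+ c) ≡ (a ℤ.- d) ℤ.+ b
  cancelˡ = solve-∀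
  cancelʳ : ∀ (a b c d : ℤ) → a ℤ.+ b ℤ.+ c ℤ.- (c ℤ.+ d) ≡ (a ℤ.- d) ℤ.+ b
  cancelʳ = solve-∀

lemma15 : (n : ℕ) (f : Word n) → IsRGF f →
          ∀ (i : Fin n) → InLrMax f i → InLwMpℤ (f′ f) i
lemma15 n f _ i lr-i j j<i =
  m-n+o≤p-q+r (f j) (u f j) (δ f j) (f i) (u f i) (δ f i) (begin
    c + u f i                  ≤⟨ +-monoʳ-≤ c (u-≤ f j<i lr-i) ⟩
    c + (u f j + (f i ∸ c))    ≡⟨ +-comm c _ ⟩
    u f j + (f i ∸ c) + c      ≡⟨ +-assoc (u f j) _ c ⟩
    u f j + (f i ∸ c + c)      ≡⟨ cong (λ k → u f j + k) (m∸n+n≡m c≤fi) ⟩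
    u f j + f i                ≡⟨ +-comm (u f j) (f i) ⟩
    f i + u f j                ≤⟨ +-monoˡ-≤ (u f j) (m≤m+n (f i) (δ f i)) ⟩
    f i + δ f i + u f j        ∎)
  where
  open ≤-Reasoning
  c = f j + δ f j
  c≤fi : c ≤ f i
  c≤fi = ≤-trans (+δ≤suc f j) (lr-i j j<i)
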